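{- Let $n,R,m$ be positive integers, $\mathcal{U}=(u_{klr}),\mathcal{V}=(v_{klr}),\mathcal{W}=(w_{ijr})\in\mathbb{R}^{n\times n\times R}$, and for $\mathbf{A},\mathbf{B}\in\mathbb{R}^{mn\times mn}$ (partitioned into $n\times n$ arrays of $m\times m$ blocks $\mathbf{A}_{kl}$, $\mathbf{B}_{k'l'}$) let $f(\mathbf{A},\mathbf{B})$ be defined blockwise by $f(\mathbf{A},\mathbf{B})_{ij}=\sum_{r=1}^R w_{ijr}\big(\sum_{k,l=1}^n u_{klr}\mathbf{A}_{kl}\big)\big(\sum_{k',l'=1}^n v_{k'l'r}\mathbf{B}_{k'l'}\big)$. Suppose $(4n+m+R-2)\varepsilon_{\mathrm{machine}}\le 0.01$ and that all entries of $\mathbf{A},\mathbf{B},\mathcal{U},\mathcal{V},\mathcal{W}$ are floating point numbers. Then, with $\mathrm{fl}(f(\mathbf{A},\mathbf{B}))$ the floating point evaluation described in the context, $$\|\mathrm{fl}(f(\mathbf{A},\mathbf{B}))-f(\mathbf{A},\mathbf{B})\|\le 1.01(4n+m+R-2)\sqrt{R}\,\varepsilon_{\mathrm{machine}}\|\mathbf{A}\|\|\mathbf{B}\|\sqrt{\sum_{r=1}^R\|\mathbf{U}_{::r}\|^2\|\mathbf{V}_{::r}\|^2\|\mathbf{W}_{::r}\|^2}.$$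
   Context: $\|\cdot\|$ is the Frobenius norm; $\mathbf{U}_{::r}\in\mathbb{R}^{n\times n}$ is the $r$-th frontal slice of $\mathcal{U}$, similarly $\mathbf{V}_{::r},\mathbf{W}_{::r}$. Floating point model: $\mathrm{fl}(x\,\mathrm{op}\,y)=(x\,\mathrm{op}\,y)(1+\Delta)$, $|\Delta|\le\varepsilon_{\mathrm{machine}}$, for floating point $x,y$ and $\mathrm{op}\in\{+,-,\times\}$; all sums are evaluated sequentially. Evaluation of $f$: the linear combinations $\sum_{k,l}u_{klr}\mathbf{A}_{kl}$ and $\sum_{k',l'}v_{k'l'r}\mathbf{B}_{k'l'}$ are computed entrywise (sequential sums over $l$, then over $k$); their $m\times m$ product is computed by the standard algorithm with each entry an inner product of length $m$ summed sequentially; multiplication by $w_{ijr}$ is in floating point; the $R$ resulting terms are summed sequentially over $r$. -}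

module Defs where

open import Data.Nat using (ℕ; zero; suc)
open import Data.Fin using (Fin; zero; suc)
open import Data.Integer using (+_)
open import Data.Rational using (ℚ; 0ℚ; 1ℚ; _+_; _*_; _≤_; ∣_∣; _/_)
open import Data.Product using (Σ; _×_)
open import Relation.Binary.PropositionalEquality using (_≡_)
open import Function using (_∘_)

∑ : ∀ {k} → (Fin k → ℚ) → ℚ
∑ {zero}  f = 0ℚ
∑ {suc k} f = f zero + ∑ (f ∘ suc)

ℕ→ℚ : ℕ → ℚ
ℕ→ℚ k = + k / 1

-- An mn × mn matrix partitioned into an n × n array of m × m blocks:
-- M k l a b is entry (a,b) of block (k,l).
BlockMat : ℕ → ℕ → Set
BlockMat m n = Fin n → Fin n → Fin m → Fin m → ℚ

Tensor : ℕ → ℕ → Set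
Tensor n R = Fin n → Fin n → Fin R → ℚ

normSq : ∀ {m n} → BlockMat m n → ℚ
normSq M = ∑ λ k → ∑ λ l → ∑ λ a → ∑ λ b → M k l a b * M k l a b

sliceNormSq : ∀ {n R} → Tensor n R → Fin R → ℚ
sliceNormSq T r = ∑ λ k → ∑ λ l → T k l r * T k l r

linComb : ∀ {m n R} → Tensor n R → BlockMat m n → Fin R → Fin m → Fin m → ℚ
linComb U A r a b = ∑ λ k → ∑ λ l → U k l r * A k l a b

fExact : ∀ {m n R} → Tensor n R → Tensor n R → Tensor n R →
         BlockMat m n → BlockMat m n → BlockMat m n
fExact U V W A B i j a b =
  ∑ λ r → W i j r * (∑ λ t → linComb U A r a t * linComb V B r t b)

record FPModel (ε : ℚ) : Set₁ where
  field
    IsFloat  : ℚ → Set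
    fladd    : ℚ → ℚ → ℚ
    flmul    : ℚ → ℚ → ℚ
    add-float : ∀ x y → IsFloat x → IsFloat y → IsFloat (fladd x y)
    mul-float : ∀ x y → IsFloat x → IsFloat y → IsFloat (flmul x y)
    add-model : ∀ x y → IsFloat x → IsFloat y →
                Σ ℚ λ Δ → (∣ Δ ∣ ≤ ε) × (fladd x y ≡ (x + y) * (1ℚ + Δ))
    mul-model : ∀ x y → IsFloat x → IsFloat y →
                Σ ℚ λ Δ → (∣ Δ ∣ ≤ ε) × (flmul x y ≡ (x * y) * (1ℚ + Δ))

module FloatEval {ε : ℚ} (M : FPModel ε) where
  open FPModel M

  flSumFrom : ∀ {k} → ℚ → (Fin k → ℚ) → ℚ
  flSumFrom {zero}  acc f = acc
  flSumFrom {suc k} acc f = flSumFrom (fladd acc (f zero)) (f ∘ suc)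

  flSum : ∀ {k} → (Fin k → ℚ) → ℚ
  flSum {zero}  f = 0ℚ
  flSum {suc k} f = flSumFrom (f zero) (f ∘ suc)

  flLinComb : ∀ {m n R} → Tensor n R → BlockMat m n → Fin R → Fin m → Fin m → ℚ
  flLinComb U A r a b = flSum λ k → flSum λ l → flmul (U k l r) (A k l a b)

  flF : ∀ {m n R} → Tensor n R → Tensor n R → Tensor n R →
        BlockMat m n → BlockMat m n → BlockMat m n
  flF U V W A B i j a b =
    flSum λ r → flmul (W i j r)
      (flSum λ t → flmul (flLinComb U A r a t) (flLinComb V B r t b))

module Submission where

-- Follow every computed quantity x̂ together with its exact value x and its
-- magnitude a, the same expression evaluated on the absolute values of the inputs. If x̂ carries
-- k rounding factors (1 + Δ) then ∣x̂ − x∣ ≤ ((1 + ε)^k − 1) a, and this invariant is preserved by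
-- rounded sums and products, the exponents adding up. An entry of fl(f) carries
-- (2n − 1) + (2n − 1) + 1 + (m − 1) + 1 + (R − 1) = 4n + m + R − 2 = K such factors, and
-- (1 + ε)^K − 1 ≤ 1.01 Kε once Kε ≤ 0.01. Cauchy–Schwarz over the blocks (k, l), over the inner
-- index of the m × m product and over r against the all-ones vector (which costs the factor R)
-- bounds the squared magnitude of each entry by a product of separate factors, and summing over
-- all entries gives R ‖A‖² ‖B‖² Σ_r ‖U_r‖² ‖V_r‖² ‖W_r‖².

open import Defs
open import Data.Nat as ℕ using (ℕ; zero; suc; NonZero; _∸_) renaming (_+_ to _+ℕ_; _*_ to _*ℕ_)
import Data.Nat.Properties as ℕ
open import Data.Nat.Tactic.RingSolver using () renaming (solve-∀ to ℕ-solve-∀)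
open import Data.Nat.Coprimality as Coprimality using ()
open import Data.Fin using (Fin; zero; suc)
open import Data.Integer as ℤ using (+_)
import Data.Integer.Properties as ℤ
open import Data.Rational using (ℚ; mkℚ; 0ℚ; 1ℚ; _+_; _-_; _*_; _≤_; _<_; _/_; -_; ∣_∣; nonNegative; positive)
open import Data.Rational.Properties
open import Algebra.Bundles using (CommutativeMonoid; CommutativeRing)
open import Algebra.Properties.CommutativeSemigroup (CommutativeMonoid.commutativeSemigroup +-0-commutativeMonoid)
  using () renaming (interchange to +-interchange)
open import Algebra.Properties.CommutativeSemigroup (CommutativeMonoid.commutativeSemigroup *-1-commutativeMonoid)
  using () renaming (interchange to *-interchange)
open import Algebra.Properties.Semiring.Exp (CommutativeRing.semiring +-*-commutativeRing) using (_^_; ^-homo-*)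
open import Tactic.RingSolver using (solve-∀)
import Tactic.RingSolver.Core.AlmostCommutativeRing as ACR
open import Data.Empty using (⊥-elim)
open import Data.Product using (_,_)
open import Data.Sum using (inj₁; inj₂)
open import Data.Unit using (tt)
open import Function using (_∘_)
open import Level using (0ℓ)
open import Relation.Nullary using (yes; no)
open import Relation.Nullary.Decidable using (dec⇒maybe)
open import Relation.Binary.PropositionalEquality

ℚ-ring : ACR.AlmostCommutativeRing 0ℓ 0ℓ
ℚ-ring = ACR.fromCommutativeRing +-*-commutativeRing (λ p → dec⇒maybe (0ℚ ≟ p))

private variable
  p q r s d : ℚ

nonNeg-gap⇒≤ : 0ℚ ≤ d → p + d ≡ q → p ≤ q
nonNeg-gap⇒≤ {d = d} {p = p} 0≤d refl = subst (_≤ p + d) (+-identityʳ p) (+-monoʳ-≤ p 0≤d)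

p≤q⇒0≤q-p : p ≤ q → 0ℚ ≤ q - p
p≤q⇒0≤q-p {p = p} {q = q} p≤q = subst (_≤ q - p) (+-inverseʳ p) (+-monoˡ-≤ (- p) p≤q)

*-monoˡ-≤′ : 0ℚ ≤ r → p ≤ q → r * p ≤ r * q
*-monoˡ-≤′ {r = r} 0≤r = *-monoˡ-≤-nonNeg r {{nonNegative 0≤r}}

*-monoʳ-≤′ : 0ℚ ≤ r → p ≤ q → p * r ≤ q * r
*-monoʳ-≤′ {r = r} 0≤r = *-monoʳ-≤-nonNeg r {{nonNegative 0≤r}}

*-mono-≤′ : 0ℚ ≤ p → 0ℚ ≤ r → p ≤ q → r ≤ s → p * r ≤ q * s
*-mono-≤′ 0≤p 0≤r p≤q r≤s = ≤-trans (*-monoʳ-≤′ 0≤r p≤q) (*-monoˡ-≤′ (≤-trans 0≤p p≤q) r≤s)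

0≤* : 0ℚ ≤ p → 0ℚ ≤ q → 0ℚ ≤ p * q
0≤* {p = p} {q = q} 0≤p 0≤q = subst (_≤ p * q) (*-zeroʳ p) (*-monoˡ-≤′ 0≤p 0≤q)

neg-square : ∀ p → - p * - p ≡ p * p
neg-square = solve-∀ ℚ-ring

0≤p*p : ∀ p → 0ℚ ≤ p * p
0≤p*p p with ≤-total 0ℚ p
... | inj₁ 0≤p = 0≤* 0≤p 0≤p
... | inj₂ p≤0 = subst (0ℚ ≤_) (neg-square p) (0≤* (neg-antimono-≤ p≤0) (neg-antimono-≤ p≤0))

∣p∣*∣p∣≡p*p : ∀ p → ∣ p ∣ * ∣ p ∣ ≡ p * p
∣p∣*∣p∣≡p*p p = trans (sym (∣p*q∣≡∣p∣*∣q∣ p p)) (0≤p⇒∣p∣≡p (0≤p*p p))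

*-self-mono-≤ : 0ℚ ≤ p → p ≤ q → p * p ≤ q * q
*-self-mono-≤ 0≤p p≤q = *-mono-≤′ 0≤p 0≤p p≤q p≤q

∣p∣≤q⇒p*p≤q*q : ∣ p ∣ ≤ q → p * p ≤ q * q
∣p∣≤q⇒p*p≤q*q {p = p} {q = q} ∣p∣≤q = subst (_≤ q * q) (∣p∣*∣p∣≡p*p p) (*-self-mono-≤ (0≤∣p∣ p) ∣p∣≤q)

p*p≤q*q⇒p≤q : 0ℚ ≤ q → p * p ≤ q * q → p ≤ q
p*p≤q*q⇒p≤q {q = q} {p = p} 0≤q pp≤qq with p ≤? q
... | yes p≤q = p≤q
... | no p≰q = ⊥-elim (<-irrefl refl (≤-<-trans pp≤qq qq<pp))
  where
  q<p : q < p
  q<p = ≰⇒> p≰q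
  qq<pp : q * q < p * p
  qq<pp = ≤-<-trans (*-monoˡ-≤′ 0≤q (<⇒≤ q<p)) (*-monoˡ-<-pos p {{positive (≤-<-trans 0≤q q<p)}} q<p)

∣*∣-mono-≤ : ∣ p ∣ ≤ r → ∣ q ∣ ≤ s → ∣ p * q ∣ ≤ r * s
∣*∣-mono-≤ {p = p} {r = r} {q = q} {s = s} ∣p∣≤r ∣q∣≤s =
  subst (_≤ r * s) (sym (∣p*q∣≡∣p∣*∣q∣ p q)) (*-mono-≤′ (0≤∣p∣ p) (0≤∣p∣ q) ∣p∣≤r ∣q∣≤s)

∣p+q+r∣≤∣p∣+∣q∣+∣r∣ : ∀ p q r → ∣ p + q + r ∣ ≤ ∣ p ∣ + ∣ q ∣ + ∣ r ∣
∣p+q+r∣≤∣p∣+∣q∣+∣r∣ p q r = ≤-trans (∣p+q∣≤∣p∣+∣q∣ (p + q) r) (+-monoˡ-≤ ∣ r ∣ (∣p+q∣≤∣p∣+∣q∣ p q))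

ℕ→ℚ≡mkℚ : ∀ k → ℕ→ℚ k ≡ mkℚ (+ k) 0 (Coprimality.sym (Coprimality.1-coprimeTo k))
ℕ→ℚ≡mkℚ k = normalize-coprime (Coprimality.sym (Coprimality.1-coprimeTo k))

ℕ→ℚ-suc : ∀ k → ℕ→ℚ (suc k) ≡ 1ℚ + ℕ→ℚ k
ℕ→ℚ-suc k rewrite ℕ→ℚ≡mkℚ k | ℕ→ℚ≡mkℚ (suc k) =
  sym (trans (/-cong {p₂ = + suc k} (cong (ℤ._+_ (+ 1)) (ℤ.*-identityʳ (+ k))) refl) (ℕ→ℚ≡mkℚ (suc k)))

0≤ℕ→ℚ : ∀ k → 0ℚ ≤ ℕ→ℚ k
0≤ℕ→ℚ k = nonNegative⁻¹ (ℕ→ℚ k) {{normalize-nonNeg k 1}}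

∑-cong : ∀ {k} {f g : Fin k → ℚ} → (∀ i → f i ≡ g i) → ∑ f ≡ ∑ g
∑-cong {zero}  f≗g = refl
∑-cong {suc k} f≗g = cong₂ _+_ (f≗g zero) (∑-cong (f≗g ∘ suc))

∑-mono-≤ : ∀ {k} {f g : Fin k → ℚ} → (∀ i → f i ≤ g i) → ∑ f ≤ ∑ g
∑-mono-≤ {zero}  f≤g = ≤-refl
∑-mono-≤ {suc k} f≤g = +-mono-≤ (f≤g zero) (∑-mono-≤ (f≤g ∘ suc))

∑-0 : ∀ k → ∑ {k} (λ _ → 0ℚ) ≡ 0ℚ
∑-0 zero    = refl
∑-0 (suc k) = trans (+-identityˡ _) (∑-0 k)

0≤∑ : ∀ {k} {f : Fin k → ℚ} → (∀ i → 0ℚ ≤ f i) → 0ℚ ≤ ∑ f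
0≤∑ {k} {f} 0≤f = subst (_≤ ∑ f) (∑-0 k) (∑-mono-≤ 0≤f)

∑-1 : ∀ k → ∑ {k} (λ _ → 1ℚ) ≡ ℕ→ℚ k
∑-1 zero    = refl
∑-1 (suc k) = trans (cong (_+_ 1ℚ) (∑-1 k)) (sym (ℕ→ℚ-suc k))

∑-distrib-+ : ∀ {k} (f g : Fin k → ℚ) → ∑ (λ i → f i + g i) ≡ ∑ f + ∑ g
∑-distrib-+ {zero}  f g = refl
∑-distrib-+ {suc k} f g = begin
  (f₀ + g₀) + ∑ (λ i → f (suc i) + g (suc i)) ≡⟨ cong (_+_ (f₀ + g₀)) (∑-distrib-+ (f ∘ suc) (g ∘ suc)) ⟩
  (f₀ + g₀) + (∑f + ∑g)                        ≡⟨ +-interchange f₀ g₀ ∑f ∑g ⟩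
  (f₀ + ∑f) + (g₀ + ∑g)                        ∎
  where
  open ≡-Reasoning
  f₀ g₀ ∑f ∑g : ℚ
  f₀ = f zero
  g₀ = g zero
  ∑f = ∑ (f ∘ suc)
  ∑g = ∑ (g ∘ suc)

*-distribˡ-∑ : ∀ {k} c (f : Fin k → ℚ) → c * ∑ f ≡ ∑ (λ i → c * f i)
*-distribˡ-∑ {zero}  c f = *-zeroʳ c
*-distribˡ-∑ {suc k} c f = trans (*-distribˡ-+ c (f zero) (∑ (f ∘ suc))) (cong (_+_ (c * f zero)) (*-distribˡ-∑ c (f ∘ suc)))

*-distribʳ-∑ : ∀ {k} c (f : Fin k → ℚ) → ∑ f * c ≡ ∑ (λ i → f i * c)
*-distribʳ-∑ c f = trans (*-comm (∑ f) c) (trans (*-distribˡ-∑ c f) (∑-cong (λ i → *-comm c (f i))))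

∑-comm : ∀ {a b} (f : Fin a → Fin b → ℚ) → ∑ (λ i → ∑ (f i)) ≡ ∑ (λ j → ∑ (λ i → f i j))
∑-comm {zero}  {b} f = sym (∑-0 b)
∑-comm {suc a} f = trans (cong (_+_ (∑ (f zero))) (∑-comm (f ∘ suc))) (sym (∑-distrib-+ (f zero) _))

*-distribˡ-∑² : ∀ {a b} c (f : Fin a → Fin b → ℚ) → c * ∑ (λ i → ∑ (f i)) ≡ ∑ (λ i → ∑ λ j → c * f i j)
*-distribˡ-∑² c f = trans (*-distribˡ-∑ c (λ i → ∑ (f i))) (∑-cong (λ i → *-distribˡ-∑ c (f i)))

*-distribʳ-∑² : ∀ {a b} c (f : Fin a → Fin b → ℚ) → ∑ (λ i → ∑ (f i)) * c ≡ ∑ (λ i → ∑ λ j → f i j * c)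
*-distribʳ-∑² c f = trans (*-distribʳ-∑ c (λ i → ∑ (f i))) (∑-cong (λ i → *-distribʳ-∑ c (f i)))

∑*∑≡∑² : ∀ {a b} (f : Fin a → ℚ) (g : Fin b → ℚ) → ∑ f * ∑ g ≡ ∑ (λ i → ∑ λ j → f i * g j)
∑*∑≡∑² f g = trans (*-distribʳ-∑ (∑ g) f) (∑-cong (λ i → *-distribˡ-∑ (f i) g))

∑²-comm : ∀ {a b c d} (F : Fin a → Fin b → Fin c → Fin d → ℚ) →
          ∑ (λ i → ∑ λ j → ∑ λ k → ∑ λ l → F i j k l) ≡ ∑ (λ k → ∑ λ l → ∑ λ i → ∑ λ j → F i j k l)
∑²-comm F = begin
  ∑ (λ i → ∑ λ j → ∑ λ k → ∑ λ l → F i j k l) ≡⟨ ∑-cong (λ i → ∑-comm (λ j k → ∑ (F i j k))) ⟩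
  ∑ (λ i → ∑ λ k → ∑ λ j → ∑ λ l → F i j k l) ≡⟨ ∑-cong (λ i → ∑-cong (λ k → ∑-comm (λ j l → F i j k l))) ⟩
  ∑ (λ i → ∑ λ k → ∑ λ l → ∑ λ j → F i j k l) ≡⟨ ∑-comm (λ i k → ∑ λ l → ∑ λ j → F i j k l) ⟩
  ∑ (λ k → ∑ λ i → ∑ λ l → ∑ λ j → F i j k l) ≡⟨ ∑-cong (λ k → ∑-comm (λ i l → ∑ λ j → F i j k l)) ⟩
  ∑ (λ k → ∑ λ l → ∑ λ i → ∑ λ j → F i j k l) ∎
  where open ≡-Reasoning

square-of-double-product : ∀ s t → (s * t + s * t) * (s * t + s * t) ≡ ((s * s) * (t * t) + (s * s) * (t * t)) + ((s * s) * (t * t) + (s * s) * (t * t))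
square-of-double-product = solve-∀ ℚ-ring

four-products-gap : ∀ x y → ((x * y + x * y) + (x * y + x * y)) + (x - y) * (x - y) ≡ (x + y) * (x + y)
four-products-gap = solve-∀ ℚ-ring

square-of-sum : ∀ s t → (s + t) * (s + t) ≡ (s * s + (s * t + s * t)) + t * t
square-of-sum = solve-∀ ℚ-ring

product-of-sums : ∀ a b c d → (a + c) * (b + d) ≡ (a * b + (a * d + c * b)) + c * d
product-of-sums = solve-∀ ℚ-ring

-- AM–GM: (2st)² = 4 s²t² ≤ 4 (ad)(cb) ≤ (ad + cb)².
double-product-≤ : ∀ {s t a b c d} → 0ℚ ≤ a → 0ℚ ≤ b → 0ℚ ≤ c → 0ℚ ≤ d →
                   s * s ≤ a * b → t * t ≤ c * d → s * t + s * t ≤ a * d + c * b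
double-product-≤ {s} {t} {a} {b} {c} {d} 0≤a 0≤b 0≤c 0≤d ss≤ab tt≤cd =
  p*p≤q*q⇒p≤q (+-mono-≤ (0≤* 0≤a 0≤d) (0≤* 0≤c 0≤b)) (begin
    (s * t + s * t) * (s * t + s * t) ≡⟨ square-of-double-product s t ⟩
    (sstt + sstt) + (sstt + sstt)     ≤⟨ +-mono-≤ (+-mono-≤ sstt≤ sstt≤) (+-mono-≤ sstt≤ sstt≤) ⟩
    (adcb + adcb) + (adcb + adcb)     ≤⟨ nonNeg-gap⇒≤ (0≤p*p (a * d - c * b)) (four-products-gap (a * d) (c * b)) ⟩
    (a * d + c * b) * (a * d + c * b) ∎)
  where
  open ≤-Reasoning
  sstt adcb : ℚ
  sstt = (s * s) * (t * t)
  adcb = (a * d) * (c * b)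
  regroup : ∀ a b c d → (a * b) * (c * d) ≡ (a * d) * (c * b)
  regroup = solve-∀ ℚ-ring
  sstt≤ : sstt ≤ adcb
  sstt≤ = ≤-trans (*-mono-≤′ (0≤p*p s) (0≤p*p t) ss≤ab tt≤cd) (≤-reflexive (regroup a b c d))

+-cauchySchwarz : ∀ {s t a b c d} → 0ℚ ≤ a → 0ℚ ≤ b → 0ℚ ≤ c → 0ℚ ≤ d →
                  s * s ≤ a * b → t * t ≤ c * d → (s + t) * (s + t) ≤ (a + c) * (b + d)
+-cauchySchwarz {s} {t} {a} {b} {c} {d} 0≤a 0≤b 0≤c 0≤d ss≤ab tt≤cd = begin
  (s + t) * (s + t)                ≡⟨ square-of-sum s t ⟩
  (s * s + (s * t + s * t)) + t * t ≤⟨ +-mono-≤ (+-mono-≤ ss≤ab (double-product-≤ {s} {t} 0≤a 0≤b 0≤c 0≤d ss≤ab tt≤cd)) tt≤cd ⟩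
  (a * b + (a * d + c * b)) + c * d ≡⟨ product-of-sums a b c d ⟨
  (a + c) * (b + d)                ∎
  where open ≤-Reasoning

∑-cauchySchwarz : ∀ {k} (s a b : Fin k → ℚ) → (∀ i → 0ℚ ≤ a i) → (∀ i → 0ℚ ≤ b i) →
                  (∀ i → s i * s i ≤ a i * b i) → ∑ s * ∑ s ≤ ∑ a * ∑ b
∑-cauchySchwarz {zero}  s a b 0≤a 0≤b ss≤ab = ≤-refl
∑-cauchySchwarz {suc k} s a b 0≤a 0≤b ss≤ab =
  +-cauchySchwarz {s zero} {∑ (s ∘ suc)} (0≤a zero) (0≤b zero) (0≤∑ (0≤a ∘ suc)) (0≤∑ (0≤b ∘ suc)) (ss≤ab zero)
    (∑-cauchySchwarz (s ∘ suc) (a ∘ suc) (b ∘ suc) (0≤a ∘ suc) (0≤b ∘ suc) (ss≤ab ∘ suc))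

∑-*-cauchySchwarz : ∀ {k} (x y : Fin k → ℚ) →
  ∑ (λ i → x i * y i) * ∑ (λ i → x i * y i) ≤ ∑ (λ i → x i * x i) * ∑ (λ i → y i * y i)
∑-*-cauchySchwarz x y = ∑-cauchySchwarz (λ i → x i * y i) (λ i → x i * x i) (λ i → y i * y i)
  (λ i → 0≤p*p (x i)) (λ i → 0≤p*p (y i)) (λ i → ≤-reflexive (*-interchange (x i) (y i) (x i) (y i)))

∑²-*-cauchySchwarz : ∀ {a b} (x y : Fin a → Fin b → ℚ) →
  ∑ (λ i → ∑ λ j → x i j * y i j) * ∑ (λ i → ∑ λ j → x i j * y i j)
    ≤ ∑ (λ i → ∑ λ j → x i j * x i j) * ∑ (λ i → ∑ λ j → y i j * y i j)
∑²-*-cauchySchwarz x y =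
  ∑-cauchySchwarz (λ i → ∑ λ j → x i j * y i j) (λ i → ∑ λ j → x i j * x i j) (λ i → ∑ λ j → y i j * y i j)
    (λ i → 0≤∑ (λ j → 0≤p*p (x i j))) (λ i → 0≤∑ (λ j → 0≤p*p (y i j))) (λ i → ∑-*-cauchySchwarz (x i) (y i))

module _ {e : ℚ} (0≤e : 0ℚ ≤ e) where

  1≤1+e : 1ℚ ≤ 1ℚ + e
  1≤1+e = nonNeg-gap⇒≤ 0≤e refl

  1≤[1+e]^ : ∀ k → 1ℚ ≤ (1ℚ + e) ^ k
  1≤[1+e]^ zero    = ≤-refl
  1≤[1+e]^ (suc k) = *-mono-≤′ (≤ᵇ⇒≤ tt) (≤ᵇ⇒≤ tt) 1≤1+e (1≤[1+e]^ k)

  [1+e]^-mono-≤ : ∀ {j k} → j ℕ.≤ k → (1ℚ + e) ^ j ≤ (1ℚ + e) ^ k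
  [1+e]^-mono-≤ {k = k} ℕ.z≤n = 1≤[1+e]^ k
  [1+e]^-mono-≤ (ℕ.s≤s j≤k)   = *-monoˡ-≤′ (≤-trans (≤ᵇ⇒≤ tt) 1≤1+e) ([1+e]^-mono-≤ j≤k)

  ℕ→ℚ-suc*e : ∀ k → ℕ→ℚ (suc k) * e ≡ e + ℕ→ℚ k * e
  ℕ→ℚ-suc*e k = trans (cong (_* e) (ℕ→ℚ-suc k)) (distrib-one e (ℕ→ℚ k))
    where
    distrib-one : ∀ e n → (1ℚ + n) * e ≡ e + n * e
    distrib-one = solve-∀ ℚ-ring

  [1+e]^k≤1+ke+[ke]² : ∀ k → ℕ→ℚ k * e ≤ 1ℚ → let x = ℕ→ℚ k * e in (1ℚ + e) ^ k ≤ 1ℚ + x + x * x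
  [1+e]^k≤1+ke+[ke]² zero    _   = nonNeg-gap⇒≤ (+-mono-≤ 0≤x (0≤p*p x)) (sym (+-assoc 1ℚ x (x * x)))
    where
    x : ℚ
    x = ℕ→ℚ 0 * e
    0≤x : 0ℚ ≤ x
    0≤x = 0≤* (0≤ℕ→ℚ 0) 0≤e
  [1+e]^k≤1+ke+[ke]² (suc k) x′≤1 = begin
    (1ℚ + e) * (1ℚ + e) ^ k          ≤⟨ *-monoˡ-≤′ (≤-trans (≤ᵇ⇒≤ tt) 1≤1+e) ([1+e]^k≤1+ke+[ke]² k x≤1) ⟩
    (1ℚ + e) * (1ℚ + x + x * x)       ≤⟨ nonNeg-gap⇒≤ gap≥0 (step-identity e x) ⟩
    1ℚ + (e + x) + (e + x) * (e + x) ≡⟨ cong (λ y → 1ℚ + y + y * y) (ℕ→ℚ-suc*e k) ⟨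
    1ℚ + x′ + x′ * x′                ∎
    where
    open ≤-Reasoning
    x x′ : ℚ
    x = ℕ→ℚ k * e
    x′ = ℕ→ℚ (suc k) * e
    x≤1 : x ≤ 1ℚ
    x≤1 = ≤-trans (nonNeg-gap⇒≤ 0≤e (trans (+-comm x e) (sym (ℕ→ℚ-suc*e k)))) x′≤1
    gap≥0 : 0ℚ ≤ e * x * (1ℚ - x) + e * e
    gap≥0 = +-mono-≤ (0≤* (0≤* 0≤e (0≤* (0≤ℕ→ℚ k) 0≤e)) (p≤q⇒0≤q-p x≤1)) (0≤p*p e)
    step-identity : ∀ e x → (1ℚ + e) * (1ℚ + x + x * x) + (e * x * (1ℚ - x) + e * e) ≡ 1ℚ + (e + x) + (e + x) * (e + x)
    step-identity = solve-∀ ℚ-ring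

  [1+e]^k-1≤[1+δ]ke : ∀ {δ} k → δ ≤ 1ℚ → ℕ→ℚ k * e ≤ δ → (1ℚ + e) ^ k - 1ℚ ≤ (1ℚ + δ) * ℕ→ℚ k * e
  [1+e]^k-1≤[1+δ]ke {δ} k δ≤1 x≤δ = begin
    (1ℚ + e) ^ k - 1ℚ   ≤⟨ +-monoˡ-≤ (- 1ℚ) ([1+e]^k≤1+ke+[ke]² k (≤-trans x≤δ δ≤1)) ⟩
    1ℚ + x + x * x - 1ℚ ≡⟨ cancel-one x ⟩
    x + x * x           ≤⟨ +-monoʳ-≤ x (*-monoˡ-≤′ (0≤* (0≤ℕ→ℚ k) 0≤e) x≤δ) ⟩
    x + x * δ           ≡⟨ collect (ℕ→ℚ k) e δ ⟩
    (1ℚ + δ) * ℕ→ℚ k * e ∎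
    where
    open ≤-Reasoning
    x : ℚ
    x = ℕ→ℚ k * e
    cancel-one : ∀ x → 1ℚ + x + x * x - 1ℚ ≡ x + x * x
    cancel-one = solve-∀ ℚ-ring
    collect : ∀ n e c → n * e + (n * e) * c ≡ (1ℚ + c) * n * e
    collect = solve-∀ ℚ-ring

linCombMagnitude : ∀ {m n R} → Tensor n R → BlockMat m n → Fin R → Fin m → Fin m → ℚ
linCombMagnitude U A r a b = ∑ λ k → ∑ λ l → ∣ U k l r ∣ * ∣ A k l a b ∣

fMagnitude : ∀ {m n R} → Tensor n R → Tensor n R → Tensor n R → BlockMat m n → BlockMat m n → BlockMat m n
fMagnitude U V W A B i j a b =
  ∑ λ r → ∣ W i j r ∣ * ∑ (λ t → linCombMagnitude U A r a t * linCombMagnitude V B r t b)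

entryNormSq : ∀ {m n} → BlockMat m n → Fin m → Fin m → ℚ
entryNormSq A a b = ∑ λ k → ∑ λ l → A k l a b * A k l a b

rowNormSq : ∀ {m n} → BlockMat m n → Fin m → ℚ
rowNormSq A a = ∑ λ t → entryNormSq A a t

colNormSq : ∀ {m n} → BlockMat m n → Fin m → ℚ
colNormSq B b = ∑ λ t → entryNormSq B t b

sliceWeight : ∀ {n R} → Tensor n R → Tensor n R → Tensor n R → Fin n → Fin n → ℚ
sliceWeight U V W i j = ∑ λ r → (W i j r * W i j r) * (sliceNormSq U r * sliceNormSq V r)

0≤sliceNormSq : ∀ {n R} (T : Tensor n R) r → 0ℚ ≤ sliceNormSq T r
0≤sliceNormSq T r = 0≤∑ (λ k → 0≤∑ (λ l → 0≤p*p (T k l r)))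

0≤entryNormSq : ∀ {m n} (A : BlockMat m n) a b → 0ℚ ≤ entryNormSq A a b
0≤entryNormSq A a b = 0≤∑ (λ k → 0≤∑ (λ l → 0≤p*p (A k l a b)))

linCombMagnitude-sq : ∀ {m n R} (U : Tensor n R) (A : BlockMat m n) r a b →
  linCombMagnitude U A r a b * linCombMagnitude U A r a b ≤ sliceNormSq U r * entryNormSq A a b
linCombMagnitude-sq U A r a b =
  subst₂ (λ P Q → linCombMagnitude U A r a b * linCombMagnitude U A r a b ≤ P * Q)
    (∑-cong (λ k → ∑-cong (λ l → ∣p∣*∣p∣≡p*p (U k l r))))
    (∑-cong (λ k → ∑-cong (λ l → ∣p∣*∣p∣≡p*p (A k l a b))))
    (∑²-*-cauchySchwarz (λ k l → ∣ U k l r ∣) (λ k l → ∣ A k l a b ∣))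

productMagnitude-sq : ∀ {m n R} (U V : Tensor n R) (A B : BlockMat m n) r a b →
  let c = ∑ (λ t → linCombMagnitude U A r a t * linCombMagnitude V B r t b) in
  c * c ≤ (sliceNormSq U r * rowNormSq A a) * (sliceNormSq V r * colNormSq B b)
productMagnitude-sq U V A B r a b = ≤-trans
  (∑-*-cauchySchwarz (λ t → linCombMagnitude U A r a t) (λ t → linCombMagnitude V B r t b))
  (*-mono-≤′ (0≤∑ (λ t → 0≤p*p (linCombMagnitude U A r a t))) (0≤∑ (λ t → 0≤p*p (linCombMagnitude V B r t b)))
    (≤-trans (∑-mono-≤ (λ t → linCombMagnitude-sq U A r a t)) (≤-reflexive (sym (*-distribˡ-∑ (sliceNormSq U r) (entryNormSq A a)))))
    (≤-trans (∑-mono-≤ (λ t → linCombMagnitude-sq V B r t b)) (≤-reflexive (sym (*-distribˡ-∑ (sliceNormSq V r) (λ t → entryNormSq B t b))))))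

fMagnitude-sq : ∀ {m n R} (U V W : Tensor n R) (A B : BlockMat m n) i j a b →
  fMagnitude U V W A B i j a b * fMagnitude U V W A B i j a b
    ≤ (ℕ→ℚ R * sliceWeight U V W i j) * (rowNormSq A a * colNormSq B b)
fMagnitude-sq {R = R} U V W A B i j a b = begin
  fMagnitude U V W A B i j a b * fMagnitude U V W A B i j a b
    ≤⟨ ∑-cauchySchwarz (λ r → ∣ w r ∣ * c r) (λ _ → 1ℚ) G (λ _ → ≤ᵇ⇒≤ tt) 0≤G term≤ ⟩
  ∑ {R} (λ _ → 1ℚ) * ∑ G
    ≡⟨ cong₂ _*_ (∑-1 R) (trans (∑-cong regroup) (sym (*-distribʳ-∑ (rowNormSq A a * colNormSq B b) (λ r → (w r * w r) * (Su r * Sv r))))) ⟩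
  ℕ→ℚ R * (sliceWeight U V W i j * (rowNormSq A a * colNormSq B b))
    ≡⟨ *-assoc (ℕ→ℚ R) _ _ ⟨
  (ℕ→ℚ R * sliceWeight U V W i j) * (rowNormSq A a * colNormSq B b) ∎
  where
  open ≤-Reasoning
  w : Fin R → ℚ
  w r = W i j r
  Su Sv : Fin R → ℚ
  Su = sliceNormSq U
  Sv = sliceNormSq V
  c : Fin R → ℚ
  c r = ∑ (λ t → linCombMagnitude U A r a t * linCombMagnitude V B r t b)
  G : Fin R → ℚ
  G r = (w r * w r) * ((Su r * rowNormSq A a) * (Sv r * colNormSq B b))
  0≤G : ∀ r → 0ℚ ≤ G r
  0≤G r = 0≤* (0≤p*p (w r)) (0≤* (0≤* (0≤sliceNormSq U r) (0≤∑ (0≤entryNormSq A a)))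
                                 (0≤* (0≤sliceNormSq V r) (0≤∑ (λ t → 0≤entryNormSq B t b))))
  term≤ : ∀ r → (∣ w r ∣ * c r) * (∣ w r ∣ * c r) ≤ 1ℚ * G r
  term≤ r = begin
    (∣ w r ∣ * c r) * (∣ w r ∣ * c r) ≡⟨ *-interchange (∣ w r ∣) (c r) (∣ w r ∣) (c r) ⟩
    (∣ w r ∣ * ∣ w r ∣) * (c r * c r) ≡⟨ cong (_* (c r * c r)) (∣p∣*∣p∣≡p*p (w r)) ⟩
    (w r * w r) * (c r * c r)         ≤⟨ *-monoˡ-≤′ (0≤p*p (w r)) (productMagnitude-sq U V A B r a b) ⟩
    G r                               ≡⟨ *-identityˡ (G r) ⟨
    1ℚ * G r                          ∎
  regroup′ : ∀ w u x v y → w * ((u * x) * (v * y)) ≡ (w * (u * v)) * (x * y)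
  regroup′ = solve-∀ ℚ-ring
  regroup : ∀ r → G r ≡ ((w r * w r) * (Su r * Sv r)) * (rowNormSq A a * colNormSq B b)
  regroup r = regroup′ (w r * w r) (Su r) (rowNormSq A a) (Sv r) (colNormSq B b)

∑-rowNormSq : ∀ {m n} (A : BlockMat m n) → ∑ (rowNormSq A) ≡ normSq A
∑-rowNormSq A = ∑²-comm (λ a t k l → A k l a t * A k l a t)

∑-colNormSq : ∀ {m n} (B : BlockMat m n) → ∑ (colNormSq B) ≡ normSq B
∑-colNormSq B = trans (∑²-comm (λ b t k l → B k l t b * B k l t b))
                      (∑-cong (λ k → ∑-cong (λ l → ∑-comm (λ b t → B k l t b * B k l t b))))

∑-sliceWeight : ∀ {n R} (U V W : Tensor n R) →
  ∑ (λ i → ∑ (sliceWeight U V W i)) ≡ ∑ (λ r → sliceNormSq U r * sliceNormSq V r * sliceNormSq W r)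
∑-sliceWeight {R = R} U V W = begin
  ∑ (λ i → ∑ λ j → ∑ λ r → (W i j r * W i j r) * (Su r * Sv r))
    ≡⟨ ∑-cong (λ i → ∑-comm (λ j r → (W i j r * W i j r) * (Su r * Sv r))) ⟩
  ∑ (λ i → ∑ λ r → ∑ λ j → (W i j r * W i j r) * (Su r * Sv r))
    ≡⟨ ∑-comm (λ i r → ∑ λ j → (W i j r * W i j r) * (Su r * Sv r)) ⟩
  ∑ (λ r → ∑ λ i → ∑ λ j → (W i j r * W i j r) * (Su r * Sv r))
    ≡⟨ ∑-cong (λ r → sym (*-distribʳ-∑² (Su r * Sv r) (λ i j → W i j r * W i j r))) ⟩
  ∑ (λ r → sliceNormSq W r * (Su r * Sv r))
    ≡⟨ ∑-cong (λ r → *-comm (sliceNormSq W r) (Su r * Sv r)) ⟩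
  ∑ (λ r → Su r * Sv r * sliceNormSq W r) ∎
  where
  open ≡-Reasoning
  Su Sv : Fin R → ℚ
  Su = sliceNormSq U
  Sv = sliceNormSq V

∑-entryBound : ∀ {m n R} κ (U V W : Tensor n R) (A B : BlockMat m n) →
  ∑ (λ i → ∑ λ j → ∑ λ a → ∑ λ b → (κ * sliceWeight U V W i j) * (rowNormSq A a * colNormSq B b))
    ≡ κ * normSq A * normSq B * ∑ (λ r → sliceNormSq U r * sliceNormSq V r * sliceNormSq W r)
∑-entryBound {n = n} κ U V W A B = begin
  ∑ (λ i → ∑ λ j → ∑ λ a → ∑ λ b → (κ * T i j) * (rowNormSq A a * colNormSq B b))
    ≡⟨ ∑-cong (λ i → ∑-cong (λ j → sym (*-distribˡ-∑² (κ * T i j) (λ a b → rowNormSq A a * colNormSq B b)))) ⟩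
  ∑ (λ i → ∑ λ j → (κ * T i j) * ∑ (λ a → ∑ λ b → rowNormSq A a * colNormSq B b))
    ≡⟨ sym (*-distribʳ-∑² (∑ (λ a → ∑ λ b → rowNormSq A a * colNormSq B b)) (λ i j → κ * T i j)) ⟩
  ∑ (λ i → ∑ λ j → κ * T i j) * ∑ (λ a → ∑ λ b → rowNormSq A a * colNormSq B b)
    ≡⟨ cong₂ _*_ (sym (*-distribˡ-∑² κ T)) (sym (∑*∑≡∑² (rowNormSq A) (colNormSq B))) ⟩
  (κ * ∑ (λ i → ∑ (T i))) * (∑ (rowNormSq A) * ∑ (colNormSq B))
    ≡⟨ cong₂ (λ S X → (κ * S) * X) (∑-sliceWeight U V W) (cong₂ _*_ (∑-rowNormSq A) (∑-colNormSq B)) ⟩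
  (κ * S) * (normSq A * normSq B)
    ≡⟨ regroup κ S (normSq A) (normSq B) ⟩
  κ * normSq A * normSq B * S ∎
  where
  open ≡-Reasoning
  T : Fin n → Fin n → ℚ
  T = sliceWeight U V W
  S : ℚ
  S = ∑ (λ r → sliceNormSq U r * sliceNormSq V r * sliceNormSq W r)
  regroup : ∀ κ S x y → (κ * S) * (x * y) ≡ κ * x * y * S
  regroup = solve-∀ ℚ-ring

flF-depth : ∀ n m R → suc (suc (suc (n +ℕ n) +ℕ suc (n +ℕ n)) +ℕ m) +ℕ R ≡ 4 *ℕ suc n +ℕ suc m +ℕ suc R ∸ 2
flF-depth n m R = cong (_∸ 2) (count n m R)
  where
  count : ∀ n m R → 2 +ℕ (suc (suc (suc (n +ℕ n) +ℕ suc (n +ℕ n)) +ℕ m) +ℕ R) ≡ 4 *ℕ suc n +ℕ suc m +ℕ suc R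
  count = ℕ-solve-∀

module RoundingError {ε : ℚ} (M : FPModel ε) where
  open FPModel M
  open FloatEval M

  0≤ε : ∀ {x} → IsFloat x → 0ℚ ≤ ε
  0≤ε {x} x-float with add-model x x x-float x-float
  ... | Δ , ∣Δ∣≤ε , _ = ≤-trans (0≤∣p∣ Δ) ∣Δ∣≤ε

  record Approx (k : ℕ) (x̂ x a : ℚ) : Set where
    field
      float : IsFloat x̂
      error : ∣ x̂ - x ∣ ≤ ((1ℚ + ε) ^ k - 1ℚ) * a
      bound : ∣ x ∣ ≤ a

  open Approx

  Approx-cong : ∀ {k k′ x̂ x x′ a a′} → k ≡ k′ → x ≡ x′ → a ≡ a′ → Approx k x̂ x a → Approx k′ x̂ x′ a′
  Approx-cong refl refl refl x̂≈x = x̂≈x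

  Approx-exact : ∀ {x} → IsFloat x → Approx 0 x x ∣ x ∣
  Approx-exact {x} x-float = record
    { float = x-float
    ; error = ≤-reflexive (begin
        ∣ x - x ∣          ≡⟨ cong ∣_∣ (+-inverseʳ x) ⟩
        0ℚ                 ≡⟨ *-zeroˡ ∣ x ∣ ⟨
        0ℚ * ∣ x ∣         ≡⟨ cong (_* ∣ x ∣) (+-inverseʳ 1ℚ) ⟨
        (1ℚ - 1ℚ) * ∣ x ∣ ∎)
    ; bound = ≤-refl
    }
    where open ≡-Reasoning

  Approx-weaken : ∀ {j k x̂ x a} → j ℕ.≤ k → Approx j x̂ x a → Approx k x̂ x a
  Approx-weaken j≤k x̂≈x = record
    { float = float x̂≈x
    ; error = ≤-trans (error x̂≈x)
        (*-monoʳ-≤′ (≤-trans (0≤∣p∣ _) (bound x̂≈x)) (+-monoˡ-≤ (- 1ℚ) ([1+e]^-mono-≤ (0≤ε (float x̂≈x)) j≤k)))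
    ; bound = bound x̂≈x
    }

  ∣x̂∣≤ : ∀ {k x̂ x a} → Approx k x̂ x a → ∣ x̂ ∣ ≤ (1ℚ + ε) ^ k * a
  ∣x̂∣≤ {k} {x̂} {x} {a} x̂≈x = begin
    ∣ x̂ ∣                          ≡⟨ cong ∣_∣ (split x̂ x) ⟩
    ∣ (x̂ - x) + x ∣                ≤⟨ ∣p+q∣≤∣p∣+∣q∣ (x̂ - x) x ⟩
    ∣ x̂ - x ∣ + ∣ x ∣              ≤⟨ +-mono-≤ (error x̂≈x) (bound x̂≈x) ⟩
    ((1ℚ + ε) ^ k - 1ℚ) * a + a ≡⟨ merge ((1ℚ + ε) ^ k) a ⟩
    (1ℚ + ε) ^ k * a               ∎
    where
    open ≤-Reasoning
    split : ∀ x̂ x → x̂ ≡ (x̂ - x) + x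
    split = solve-∀ ℚ-ring
    merge : ∀ P a → (P - 1ℚ) * a + a ≡ P * a
    merge = solve-∀ ℚ-ring

  Approx-fladd : ∀ {k x̂ x a ŷ y b} → Approx k x̂ x a → Approx k ŷ y b →
                 Approx (suc k) (fladd x̂ ŷ) (x + y) (a + b)
  Approx-fladd {k} {x̂} {x} {a} {ŷ} {y} {b} x̂≈x ŷ≈y with add-model x̂ ŷ (float x̂≈x) (float ŷ≈y)
  ... | Δ , ∣Δ∣≤ε , fladd≡ = record
    { float = add-float x̂ ŷ (float x̂≈x) (float ŷ≈y)
    ; error = begin
        ∣ fladd x̂ ŷ - (x + y) ∣                          ≡⟨ cong (λ z → ∣ z - (x + y) ∣) fladd≡ ⟩
        ∣ (x̂ + ŷ) * (1ℚ + Δ) - (x + y) ∣                 ≡⟨ cong ∣_∣ (split x̂ ŷ x y Δ) ⟩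
        ∣ (x̂ - x) + (ŷ - y) + (x̂ + ŷ) * Δ ∣             ≤⟨ ∣p+q+r∣≤∣p∣+∣q∣+∣r∣ (x̂ - x) (ŷ - y) ((x̂ + ŷ) * Δ) ⟩
        ∣ x̂ - x ∣ + ∣ ŷ - y ∣ + ∣ (x̂ + ŷ) * Δ ∣         ≤⟨ +-mono-≤ (+-mono-≤ (error x̂≈x) (error ŷ≈y)) rounding≤ ⟩
        (P - 1ℚ) * a + (P - 1ℚ) * b + (P * a + P * b) * ε ≡⟨ collect P ε a b ⟩
        ((1ℚ + ε) * P - 1ℚ) * (a + b)                     ∎
    ; bound = ≤-trans (∣p+q∣≤∣p∣+∣q∣ x y) (+-mono-≤ (bound x̂≈x) (bound ŷ≈y))
    }
    where
    open ≤-Reasoning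
    P : ℚ
    P = (1ℚ + ε) ^ k
    rounding≤ : ∣ (x̂ + ŷ) * Δ ∣ ≤ (P * a + P * b) * ε
    rounding≤ = ∣*∣-mono-≤ (≤-trans (∣p+q∣≤∣p∣+∣q∣ x̂ ŷ) (+-mono-≤ (∣x̂∣≤ x̂≈x) (∣x̂∣≤ ŷ≈y))) ∣Δ∣≤ε
    split : ∀ x̂ ŷ x y Δ → (x̂ + ŷ) * (1ℚ + Δ) - (x + y) ≡ (x̂ - x) + (ŷ - y) + (x̂ + ŷ) * Δ
    split = solve-∀ ℚ-ring
    collect : ∀ P ε a b → (P - 1ℚ) * a + (P - 1ℚ) * b + (P * a + P * b) * ε ≡ ((1ℚ + ε) * P - 1ℚ) * (a + b)
    collect = solve-∀ ℚ-ring

  Approx-flmul : ∀ {j k x̂ x a ŷ y b} → Approx j x̂ x a → Approx k ŷ y b →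
                 Approx (suc (j +ℕ k)) (flmul x̂ ŷ) (x * y) (a * b)
  Approx-flmul {j} {k} {x̂} {x} {a} {ŷ} {y} {b} x̂≈x ŷ≈y with mul-model x̂ ŷ (float x̂≈x) (float ŷ≈y)
  ... | Δ , ∣Δ∣≤ε , flmul≡ = record
    { float = mul-float x̂ ŷ (float x̂≈x) (float ŷ≈y)
    ; error = begin
        ∣ flmul x̂ ŷ - x * y ∣                                ≡⟨ cong (λ z → ∣ z - x * y ∣) flmul≡ ⟩
        ∣ (x̂ * ŷ) * (1ℚ + Δ) - x * y ∣                       ≡⟨ cong ∣_∣ (split x̂ ŷ x y Δ) ⟩
        ∣ (x̂ - x) * ŷ + x * (ŷ - y) + (x̂ * ŷ) * Δ ∣         ≤⟨ ∣p+q+r∣≤∣p∣+∣q∣+∣r∣ ((x̂ - x) * ŷ) (x * (ŷ - y)) ((x̂ * ŷ) * Δ) ⟩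
        ∣ (x̂ - x) * ŷ ∣ + ∣ x * (ŷ - y) ∣ + ∣ (x̂ * ŷ) * Δ ∣
          ≤⟨ +-mono-≤ (+-mono-≤ (∣*∣-mono-≤ (error x̂≈x) (∣x̂∣≤ ŷ≈y)) (∣*∣-mono-≤ (bound x̂≈x) (error ŷ≈y)))
                      (∣*∣-mono-≤ (∣*∣-mono-≤ (∣x̂∣≤ x̂≈x) (∣x̂∣≤ ŷ≈y)) ∣Δ∣≤ε) ⟩
        (P - 1ℚ) * a * (Q * b) + a * ((Q - 1ℚ) * b) + (P * a * (Q * b)) * ε ≡⟨ collect P Q ε a b ⟩
        ((1ℚ + ε) * (P * Q) - 1ℚ) * (a * b)                  ≡⟨ cong (λ z → ((1ℚ + ε) * z - 1ℚ) * (a * b)) (^-homo-* (1ℚ + ε) j k) ⟨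
        ((1ℚ + ε) * (1ℚ + ε) ^ (j +ℕ k) - 1ℚ) * (a * b)      ∎
    ; bound = ∣*∣-mono-≤ (bound x̂≈x) (bound ŷ≈y)
    }
    where
    open ≤-Reasoning
    P Q : ℚ
    P = (1ℚ + ε) ^ j
    Q = (1ℚ + ε) ^ k
    split : ∀ x̂ ŷ x y Δ → (x̂ * ŷ) * (1ℚ + Δ) - x * y ≡ (x̂ - x) * ŷ + x * (ŷ - y) + (x̂ * ŷ) * Δ
    split = solve-∀ ℚ-ring
    collect : ∀ P Q ε a b → (P - 1ℚ) * a * (Q * b) + a * ((Q - 1ℚ) * b) + (P * a * (Q * b)) * ε
                          ≡ ((1ℚ + ε) * (P * Q) - 1ℚ) * (a * b)
    collect = solve-∀ ℚ-ring

  Approx-flSumFrom : ∀ {K j ŝ s a} {x̂ x b : Fin K → ℚ} → Approx j ŝ s a → (∀ i → Approx j (x̂ i) (x i) (b i)) →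
                     Approx (j +ℕ K) (flSumFrom ŝ x̂) (s + ∑ x) (a + ∑ b)
  Approx-flSumFrom {zero} {j} {s = s} {a} ŝ≈s _ =
    Approx-cong (sym (ℕ.+-identityʳ j)) (sym (+-identityʳ s)) (sym (+-identityʳ a)) ŝ≈s
  Approx-flSumFrom {suc K} {j} {s = s} {a} {x = x} {b} ŝ≈s x̂≈x =
    Approx-cong (sym (ℕ.+-suc j K)) (+-assoc s (x zero) _) (+-assoc a (b zero) _)
      (Approx-flSumFrom (Approx-fladd ŝ≈s (x̂≈x zero)) (λ i → Approx-weaken (ℕ.n≤1+n j) (x̂≈x (suc i))))

  Approx-flSum : ∀ {K j} {x̂ x a : Fin (suc K) → ℚ} → (∀ i → Approx j (x̂ i) (x i) (a i)) →
                 Approx (j +ℕ K) (flSum x̂) (∑ x) (∑ a)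
  Approx-flSum x̂≈x = Approx-flSumFrom (x̂≈x zero) (x̂≈x ∘ suc)

  flLinComb-approx : ∀ {m n R} (X : Tensor (suc n) R) (Y : BlockMat m (suc n)) →
    (∀ k l r → IsFloat (X k l r)) → (∀ k l a b → IsFloat (Y k l a b)) →
    ∀ r a b → Approx (suc (n +ℕ n)) (flLinComb X Y r a b) (linComb X Y r a b) (linCombMagnitude X Y r a b)
  flLinComb-approx X Y X-float Y-float r a b =
    Approx-flSum (λ k → Approx-flSum (λ l → Approx-flmul (Approx-exact (X-float k l r)) (Approx-exact (Y-float k l a b))))

  module _ {n m R : ℕ} (U V W : Tensor (suc n) (suc R)) (A B : BlockMat (suc m) (suc n))
           (U-float : ∀ k l r → IsFloat (U k l r)) (V-float : ∀ k l r → IsFloat (V k l r))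
           (W-float : ∀ k l r → IsFloat (W k l r))
           (A-float : ∀ k l a b → IsFloat (A k l a b)) (B-float : ∀ k l a b → IsFloat (B k l a b)) where

    K : ℕ
    K = 4 *ℕ suc n +ℕ suc m +ℕ suc R ∸ 2

    flF-approx : ∀ i j a b → Approx K (flF U V W A B i j a b) (fExact U V W A B i j a b) (fMagnitude U V W A B i j a b)
    flF-approx i j a b = Approx-cong (flF-depth n m R) refl refl
      (Approx-flSum (λ r → Approx-flmul (Approx-exact (W-float i j r))
        (Approx-flSum (λ t → Approx-flmul (flLinComb-approx U A U-float A-float r a t)
                                          (flLinComb-approx V B V-float B-float r t b)))))

    flF-error-sq : ℕ→ℚ K * ε ≤ + 1 / 100 → ∀ i j a b →
      let E = flF U V W A B i j a b - fExact U V W A B i j a b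
          c = (+ 101 / 100) * ℕ→ℚ K * ε
      in E * E ≤ (c * c * ℕ→ℚ (suc R) * sliceWeight U V W i j) * (rowNormSq A a * colNormSq B b)
    flF-error-sq Kε≤ i j a b = begin
      E * E                         ≤⟨ ∣p∣≤q⇒p*p≤q*q (error (flF-approx i j a b)) ⟩
      (γ * f) * (γ * f)             ≡⟨ *-interchange γ f γ f ⟩
      (γ * γ) * (f * f)             ≤⟨ *-mono-≤′ (0≤p*p γ) (0≤p*p f) (*-self-mono-≤ 0≤γ γ≤c) (fMagnitude-sq U V W A B i j a b) ⟩
      (c * c) * ((ℕ→ℚ (suc R) * T) * X) ≡⟨ regroup (c * c) (ℕ→ℚ (suc R)) T X ⟩
      (c * c * ℕ→ℚ (suc R) * T) * X ∎
      where
      open ≤-Reasoning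
      E γ f c T X : ℚ
      E = flF U V W A B i j a b - fExact U V W A B i j a b
      γ = (1ℚ + ε) ^ K - 1ℚ
      f = fMagnitude U V W A B i j a b
      c = (+ 101 / 100) * ℕ→ℚ K * ε
      T = sliceWeight U V W i j
      X = rowNormSq A a * colNormSq B b
      0≤ε′ : 0ℚ ≤ ε
      0≤ε′ = 0≤ε (U-float zero zero zero)
      0≤γ : 0ℚ ≤ γ
      0≤γ = p≤q⇒0≤q-p (1≤[1+e]^ 0≤ε′ K)
      γ≤c : γ ≤ c
      γ≤c = [1+e]^k-1≤[1+δ]ke 0≤ε′ K (≤ᵇ⇒≤ tt) Kε≤
      regroup : ∀ cc r t x → cc * ((r * t) * x) ≡ (cc * r * t) * x
      regroup = solve-∀ ℚ-ring

proposition6 : (n R m : ℕ) → .{{_ : NonZero n}} → .{{_ : NonZero R}} → .{{_ : NonZero m}} →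
    (ε : ℚ) → (M : FPModel ε) →
    (U V W : Tensor n R) → (A B : BlockMat m n) →
    ℕ→ℚ (4 *ℕ n +ℕ m +ℕ R ∸ 2) * ε ≤ + 1 / 100 →
    (∀ k l r → FPModel.IsFloat M (U k l r)) →
    (∀ k l r → FPModel.IsFloat M (V k l r)) →
    (∀ k l r → FPModel.IsFloat M (W k l r)) →
    (∀ k l a b → FPModel.IsFloat M (A k l a b)) →
    (∀ k l a b → FPModel.IsFloat M (B k l a b)) →
    normSq (λ i j a b → FloatEval.flF M U V W A B i j a b - fExact U V W A B i j a b)
      ≤ ((+ 101 / 100) * ℕ→ℚ (4 *ℕ n +ℕ m +ℕ R ∸ 2) * ε)
        * ((+ 101 / 100) * ℕ→ℚ (4 *ℕ n +ℕ m +ℕ R ∸ 2) * ε)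
        * ℕ→ℚ R * normSq A * normSq B
        * ∑ (λ r → sliceNormSq U r * sliceNormSq V r * sliceNormSq W r)
proposition6 n@(suc _) R@(suc _) m@(suc _) ε M U V W A B Kε≤ U-float V-float W-float A-float B-float = begin
  normSq (λ i j a b → flF U V W A B i j a b - fExact U V W A B i j a b)
    ≤⟨ ∑-mono-≤ (λ i → ∑-mono-≤ (λ j → ∑-mono-≤ (λ a → ∑-mono-≤ (λ b →
         flF-error-sq U V W A B U-float V-float W-float A-float B-float Kε≤ i j a b)))) ⟩
  ∑ (λ i → ∑ λ j → ∑ λ a → ∑ λ b → (κ * sliceWeight U V W i j) * (rowNormSq A a * colNormSq B b))
    ≡⟨ ∑-entryBound κ U V W A B ⟩
  κ * normSq A * normSq B * ∑ (λ r → sliceNormSq U r * sliceNormSq V r * sliceNormSq W r) ∎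
  where
  open FloatEval M
  open RoundingError M
  open ≤-Reasoning
  c κ : ℚ
  c = (+ 101 / 100) * ℕ→ℚ (4 *ℕ n +ℕ m +ℕ R ∸ 2) * ε
  κ = c * c * ℕ→ℚ R
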